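{- Let $a,b,c$ be positive integers and set $\hat a=b+c$, $\hat b=a+c$, $\hat c=a+b$. Let $\alpha$ be the representation map of the $\mathfrak{sl}(2,\mathbb{C})$-representation $V_{\hat a-1}\otimes V_{\hat b-1}\otimes V_{\hat c-1}$, given with the basis which is the tensor product of the weight bases of the three factors. Then the matrix of $\alpha(X)|_{ -1}$, the restriction of $\alpha(X)$ to the eigenspace of $\alpha(H)$ with eigenvalue $-1$ (mapping into the eigenspace with eigenvalue $1$), is (under a suitable identification of basis vectors with vertices) a Kasteleyn-flat weighted bipartite adjacency matrix for $Z(a,b,c)$.
   Context: Let $H(a,b,c)$ be the hexagon in the triangular lattice (of unit equilateral triangles) with all angles $120^\circ$ and side lengths $a,b,c,a,b,c$ in cyclic order; it is tiled by unit triangles. $Z(a,b,c)$ is the bipartite planar graph whose vertices are these unit triangles (colour classes = the two orientations of triangles) and whose edges join triangles sharing a side; its bounded faces are hexagons. A weighted bipartite adjacency matrix of a bipartite graph with colour classes of equal size has rows indexed by one class and columns by the other, with $(u,w)$ entry a nonzero weight if $u,w$ are adjacent and $0$ otherwise; it is Kasteleyn-flat if for every hexagonal face with edge weights $w_1,\dots,w_6$ in cyclic order, $w_1w_3w_5=w_2w_4w_6$. $\mathfrak{sl}(2,\mathbb{C})$ has basis $H=\begin{pmatrix}1&0\\0&-1\end{pmatrix}$, $X=\begin{pmatrix}0&1\\0&0\end{pmatrix}$, $Y=\begin{pmatrix}0&0\\1&0\end{pmatrix}$. $V_n$ is the irreducible $(n+1)$-dimensional representation on degree-$n$ homogeneous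 polynomials in $x,y$ with $X=x\,\partial/\partial y$, $Y=y\,\partial/\partial x$, $H=x\,\partial/\partial x-y\,\partial/\partial y$; its weight basis is $e_{n-2j}=x^{n-j}y^j$, $j=0,\dots,n$, with $He_{n-2j}=(n-2j)e_{n-2j}$, $Xe_{n-2j}=j\,e_{n-2j+2}$, $Ye_{n-2j}=(n-j)e_{n-2j-2}$. On a tensor product, $L$ acts by $L\otimes I\otimes I+I\otimes L\otimes I+I\otimes I\otimes L$. -}

module Defs where

open import Data.Nat as ℕ using (ℕ; zero; suc; _∸_)
open import Data.Fin using (Fin; toℕ; _≟_)
open import Data.Integer as ℤ using (ℤ; +_; _-_; _≤_)
open import Data.Product using (Σ; _×_; _,_; proj₁)
open import Relation.Nullary using (¬_; does)
open import Relation.Binary.PropositionalEquality using (_≡_)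
open import Data.Bool using (if_then_else_)
open import Function.Bundles using (_⇔_; _↔_; Inverse)

-- Weight basis of V_n: the index j : Fin (suc n) stands for
-- e_{n-2j} = x^{n-j} y^j  (j = 0, … , n).
VBasis : ℕ → Set
VBasis n = Fin (suc n)

vWeight : (n : ℕ) → VBasis n → ℤ
vWeight n j = + n - + (2 ℕ.* toℕ j)

-- Matrix entry of X on V_n: coefficient of the basis vector i in X(e_j).
-- X e_{n-2j} = j e_{n-2j+2}, i.e. X(j) = j · (j-1).
vX : (n : ℕ) → VBasis n → VBasis n → ℕ
vX n i j = if does (suc (toℕ i) ℕ.≟ toℕ j) then toℕ j else 0

δ : {n : ℕ} → Fin n → Fin n → ℕ
δ i j = if does (i ≟ j) then 1 else 0

TBasis : ℕ → ℕ → ℕ → Set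
TBasis n₁ n₂ n₃ = VBasis n₁ × VBasis n₂ × VBasis n₃

-- α(H) is diagonal in the tensor basis with these eigenvalues.
tWeight : (n₁ n₂ n₃ : ℕ) → TBasis n₁ n₂ n₃ → ℤ
tWeight n₁ n₂ n₃ (j₁ , j₂ , j₃) = vWeight n₁ j₁ ℤ.+ vWeight n₂ j₂ ℤ.+ vWeight n₃ j₃

tX : (n₁ n₂ n₃ : ℕ) → TBasis n₁ n₂ n₃ → TBasis n₁ n₂ n₃ → ℕ
tX n₁ n₂ n₃ (i₁ , i₂ , i₃) (j₁ , j₂ , j₃) =
  vX n₁ i₁ j₁ ℕ.* δ i₂ j₂ ℕ.* δ i₃ j₃
  ℕ.+ δ i₁ j₁ ℕ.* vX n₂ i₂ j₂ ℕ.* δ i₃ j₃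
  ℕ.+ δ i₁ j₁ ℕ.* δ i₂ j₂ ℕ.* vX n₃ i₃ j₃

module Rep (a b c : ℕ) where
  n₁ n₂ n₃ : ℕ
  n₁ = (b ℕ.+ c) ∸ 1
  n₂ = (a ℕ.+ c) ∸ 1
  n₃ = (a ℕ.+ b) ∸ 1

  Basis : Set
  Basis = TBasis n₁ n₂ n₃

  -- Basis of the α(H)-eigenspace with eigenvalue k (the tensor basis is
  -- an eigenbasis, so these basis vectors span that eigenspace).
  EigBasis : ℤ → Set
  EigBasis k = Σ Basis (λ v → tWeight n₁ n₂ n₃ v ≡ k)

  Xm1 : EigBasis (+ 1) → EigBasis (ℤ.- (+ 1)) → ℕ
  Xm1 u v = tX n₁ n₂ n₃ (proj₁ u) (proj₁ v)

-- The hexagon H(a,b,c) and the graph Z(a,b,c)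
-- Lattice points of the triangular lattice: x·e₁ + y·e₂ with (x,y) ∈ ℤ²,
-- e₁, e₂ unit vectors at angle 60°.
-- Up-triangle   U(x,y) has vertices (x,y), (x+1,y), (x,y+1).
-- Down-triangle D(x,y) has vertices (x+1,y), (x,y+1), (x+1,y+1).
-- H(a,b,c): the (closed, convex) hexagon with vertices
-- (0,0), (a,0), (a,b), (a-c,b+c), (-c,b+c), (-c,c); its sides have
-- lengths a,b,c,a,b,c in cyclic order and all angles are 120°.

module Hex (a b c : ℕ) where
  InHex : ℤ → ℤ → Set
  InHex x y = (+ 0 ≤ y × y ≤ + (b ℕ.+ c))
            × (ℤ.- (+ c) ≤ x × x ≤ + a)
            × (+ 0 ≤ x ℤ.+ y × x ℤ.+ y ≤ + (a ℕ.+ b))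

  -- a unit triangle lies in H(a,b,c) iff its three vertices do (convexity)
  UpIn : ℤ → ℤ → Set
  UpIn x y = InHex x y × InHex (x ℤ.+ + 1) y × InHex x (y ℤ.+ + 1)

  DownIn : ℤ → ℤ → Set
  DownIn x y = InHex (x ℤ.+ + 1) y × InHex x (y ℤ.+ + 1)
             × InHex (x ℤ.+ + 1) (y ℤ.+ + 1)

  -- the two colour classes of Z(a,b,c)
  Up : Set
  Up = Σ (ℤ × ℤ) (λ p → UpIn (proj₁ p) (Data.Product.proj₂ p))

  Down : Set
  Down = Σ (ℤ × ℤ) (λ p → DownIn (proj₁ p) (Data.Product.proj₂ p))

  -- U(x,y) shares a side with exactly D(x,y), D(x-1,y), D(x,y-1).
  Adj : Up → Down → Set
  Adj ((x , y) , _) ((x' , y') , _) =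
      ((x' ≡ x) × (y' ≡ y))
    Data.Sum.⊎ (((x' ≡ x - + 1) × (y' ≡ y))
    Data.Sum.⊎ ((x' ≡ x) × (y' ≡ y - + 1)))
    where import Data.Sum

  -- The bounded faces of Z(a,b,c) are the hexagons
  -- around the interior lattice points (x,y) of H(a,b,c), i.e. the points all
  -- six of whose surrounding triangles lie in H(a,b,c); in cyclic order these
  -- are U(x,y), D(x-1,y), U(x-1,y), D(x-1,y-1), U(x,y-1), D(x,y-1).
  IsKFlatAdjacency : (Up → Down → ℕ) → Set
  IsKFlatAdjacency w =
    (∀ U D → (¬ (w U D ≡ 0)) ⇔ Adj U D)
    × (∀ x y
         (p₁ : UpIn x y) (p₂ : DownIn (x - + 1) y)
         (p₃ : UpIn (x - + 1) y) (p₄ : DownIn (x - + 1) (y - + 1))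
         (p₅ : UpIn x (y - + 1)) (p₆ : DownIn x (y - + 1)) →
         let U₁ = ((x , y) , p₁)
             D₂ = ((x - + 1 , y) , p₂)
             U₃ = ((x - + 1 , y) , p₃)
             D₄ = ((x - + 1 , y - + 1) , p₄)
             U₅ = ((x , y - + 1) , p₅)
             D₆ = ((x , y - + 1) , p₆)
         in w U₁ D₂ ℕ.* w U₃ D₄ ℕ.* w U₅ D₆
            ≡ w U₃ D₂ ℕ.* w U₅ D₄ ℕ.* w U₁ D₆)

module Submission where

-- The tensor basis vector e_{n₁-2p} ⊗ e_{n₂-2q} ⊗ e_{n₃-2r} has α(H)-weight n₁ + n₂ + n₃ - 2(p + q + r)
-- = 2N - 3 - 2(p + q + r), where N = a + b + c, so it lies in the (-1)-eigenspace iff p + q + r = N - 1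
-- and in the (+1)-eigenspace iff p + q + r = N - 2.  Sending it to the up-triangle U(q - c , p), resp. the
-- down-triangle D(q - c , p), identifies the two eigenbases with the colour classes of Z(a,b,c): the
-- bounds p ≤ n₁, q ≤ n₂, r ≤ n₃ are exactly the conditions for the triangle to lie in H(a,b,c).
-- α(X) lowers one of the three indices by one, with coefficient the old index; the three choices of index
-- are the three neighbours D(x,y), D(x-1,y), D(x,y-1) of U(x,y), so the matrix is supported exactly on
-- the edges, and around the face at (x,y) both alternating products equal (x + c) · y · (N - x - y - c).

open import Defs
open import Data.Nat using (ℕ; _<_)
open import Data.Integer using (+_; -_)
open import Data.Sum using (_⊎_)
open import Data.Product using (Σ; _×_)
open import Function.Bundles using (_↔_; Inverse)

open import Data.Nat using (zero; suc; _≤_; _+_; _*_; _∸_)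
import Data.Nat as ℕ
import Data.Nat.Properties as ℕ
open import Data.Integer using (ℤ; ∣_∣; +≤+) renaming (_+_ to _+ᶻ_; _-_ to _-ᶻ_; _≤_ to _≤ᶻ_)
import Data.Integer.Properties as ℤ
open import Data.Integer.Tactic.RingSolver using (solve-∀)
open import Data.Fin using (Fin; toℕ; fromℕ<)
import Data.Fin as Fin
open import Data.Fin.Properties using (toℕ-injective; toℕ<n; toℕ-fromℕ<; fromℕ<-toℕ)
open import Data.Product using (_,_; proj₁; proj₂)
open import Data.Product.Properties using (,-injectiveˡ; ,-injectiveʳ)
open import Data.Sum using (inj₁; inj₂)
open import Data.Bool using (if_then_else_)
open import Function.Bundles using (_⇔_; mk⇔; mk↔ₛ′; Equivalence)
open import Axiom.UniquenessOfIdentityProofs using (module Decidable⇒UIP)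
open import Function.Properties.Equivalence using () renaming (trans to ⇔-trans)
open import Function.Properties.Inverse using (↔-trans; ↔-sym)
open import Data.Product.Function.NonDependent.Propositional using (_×-⇔_)
open import Data.Sum.Function.Propositional using (_⊎-⇔_)
open import Relation.Binary.PropositionalEquality
open import Relation.Nullary using (yes; no)
open import Relation.Nullary.Decidable using (dec-true; dec-false)
open import Relation.Nullary.Irrelevant using (Irrelevant)
open import Data.Empty using (⊥-elim)
open import Data.List using (_∷_; [])
open import Data.Nat.Tactic.RingSolver using (solve)
open import Algebra.Properties.AbelianGroup ℤ.+-0-abelianGroup using () renaming (∙-cancelʳ to +ᶻ-cancelʳ-≡)
open ≡-Reasoning

×-irrelevant : {A B : Set} → Irrelevant A → Irrelevant B → Irrelevant (A × B)
×-irrelevant A-irr B-irr (a , b) (a′ , b′) = cong₂ _,_ (A-irr a a′) (B-irr b b′)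

module _ {A : Set} {P : A → Set} (P-irr : ∀ a → Irrelevant (P a)) where

  proj₁-injective : {p q : Σ A P} → proj₁ p ≡ proj₁ q → p ≡ q
  proj₁-injective {a , p} {.a , q} refl = cong (a ,_) (P-irr a p q)

Σ-↔-proj₁ : {A B : Set} {P : A → Set} {Q : B → Set} →
  (∀ a → Irrelevant (P a)) → (∀ b → Irrelevant (Q b)) →
  (to : Σ A P → Σ B Q) (from : Σ B Q → Σ A P) →
  (∀ q → proj₁ (to (from q)) ≡ proj₁ q) → (∀ p → proj₁ (from (to p)) ≡ proj₁ p) →
  Σ A P ↔ Σ B Q
Σ-↔-proj₁ P-irr Q-irr to from to∘from from∘to =
  mk↔ₛ′ to from (λ q → proj₁-injective Q-irr (to∘from q)) (λ p → proj₁-injective P-irr (from∘to p))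

+≢0 : ∀ m n → m + n ≢ 0 → m ≢ 0 ⊎ n ≢ 0
+≢0 zero    n n≢0 = inj₂ n≢0
+≢0 (suc m) n _   = inj₁ ℕ.1+n≢0

*≢0 : ∀ m n → m * n ≢ 0 → m ≢ 0 × n ≢ 0
*≢0 m n mn≢0 = (λ m≡0 → mn≢0 (cong (_* n) m≡0)) , (λ n≡0 → mn≢0 (trans (cong (m *_) n≡0) (ℕ.*-zeroʳ m)))

*-*-≢0 : ∀ l m n → l * m * n ≢ 0 → l ≢ 0 × m ≢ 0 × n ≢ 0
*-*-≢0 l m n lmn≢0 = let lm≢0 , n≢0 = *≢0 (l * m) n lmn≢0 ; l≢0 , m≢0 = *≢0 l m lm≢0 in l≢0 , m≢0 , n≢0

δ-refl : ∀ {n} (i : Fin n) → δ i i ≡ 1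
δ-refl i = cong (if_then 1 else 0) (dec-true (i Fin.≟ i) refl)

δ-≢ : ∀ {n} {i j : Fin n} → i ≢ j → δ i j ≡ 0
δ-≢ {i = i} {j} i≢j = cong (if_then 1 else 0) (dec-false (i Fin.≟ j) i≢j)

δ≢0⇒≡ : ∀ {n} {i j : Fin n} → δ i j ≢ 0 → i ≡ j
δ≢0⇒≡ {i = i} {j} δ≢0 with i Fin.≟ j
... | yes i≡j = i≡j
... | no _ = ⊥-elim (δ≢0 refl)

vX-step : ∀ {n} {i j : Fin (suc n)} → suc (toℕ i) ≡ toℕ j → vX n i j ≡ toℕ j
vX-step {i = i} {j} step = cong (if_then toℕ j else 0) (dec-true (suc (toℕ i) ℕ.≟ toℕ j) step)

vX-nonstep : ∀ {n} {i j : Fin (suc n)} → suc (toℕ i) ≢ toℕ j → vX n i j ≡ 0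
vX-nonstep {i = i} {j} ¬step = cong (if_then toℕ j else 0) (dec-false (suc (toℕ i) ℕ.≟ toℕ j) ¬step)

vX-refl : ∀ {n} (i : Fin (suc n)) → vX n i i ≡ 0
vX-refl i = vX-nonstep {i = i} {j = i} ℕ.1+n≢n

vX≢0⇒step : ∀ {n} {i j : Fin (suc n)} → vX n i j ≢ 0 → suc (toℕ i) ≡ toℕ j
vX≢0⇒step {i = i} {j} vX≢0 with suc (toℕ i) ℕ.≟ toℕ j
... | yes step = step
... | no ¬step = ⊥-elim (vX≢0 (vX-nonstep ¬step))

step⇒≢ : ∀ {n} {i j : Fin n} → suc (toℕ i) ≡ toℕ j → i ≢ j
step⇒≢ step refl = ℕ.1+n≢n step

-- Hex.Adj read in the coordinates (x + c , y), with the same three cases in the same order.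
AtSame OneLeft OneBelow AdjCoords : ℕ × ℕ → ℕ × ℕ → Set
AtSame   (q , p) (q′ , p′) = q′ ≡ q × p′ ≡ p
OneLeft  (q , p) (q′ , p′) = suc q′ ≡ q × p′ ≡ p
OneBelow (q , p) (q′ , p′) = q′ ≡ q × suc p′ ≡ p
AdjCoords t t′ = AtSame t t′ ⊎ OneLeft t t′ ⊎ OneBelow t t′

module _ {n₁ n₂ n₃ : ℕ} where

  level : TBasis n₁ n₂ n₃ → ℕ
  level (j₁ , j₂ , j₃) = toℕ j₁ + toℕ j₂ + toℕ j₃

  position : TBasis n₁ n₂ n₃ → ℕ × ℕ
  position (j₁ , j₂ , _) = toℕ j₂ , toℕ j₁

  tWeight+2level : ∀ v → tWeight n₁ n₂ n₃ v +ᶻ + (2 * level v) ≡ + (n₁ + n₂ + n₃)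
  tWeight+2level (j₁ , j₂ , j₃) = begin
    tWeight n₁ n₂ n₃ (j₁ , j₂ , j₃) +ᶻ + (2 * (p + q + r))
      ≡⟨ cong (λ k → tWeight n₁ n₂ n₃ (j₁ , j₂ , j₃) +ᶻ + k) (2*-distrib p q r) ⟩
    (+ n₁ -ᶻ + (2 * p)) +ᶻ (+ n₂ -ᶻ + (2 * q)) +ᶻ (+ n₃ -ᶻ + (2 * r)) +ᶻ (+ (2 * p) +ᶻ + (2 * q) +ᶻ + (2 * r))
      ≡⟨ cancel (+ n₁) (+ n₂) (+ n₃) (+ (2 * p)) (+ (2 * q)) (+ (2 * r)) ⟩
    + (n₁ + n₂ + n₃) ∎
    where
    p = toℕ j₁
    q = toℕ j₂
    r = toℕ j₃
    2*-distrib : ∀ p q r → 2 * (p + q + r) ≡ 2 * p + 2 * q + 2 * r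
    2*-distrib p q r = solve (p ∷ q ∷ r ∷ [])
    cancel : ∀ x₁ x₂ x₃ y₁ y₂ y₃ →
             (x₁ -ᶻ y₁) +ᶻ (x₂ -ᶻ y₂) +ᶻ (x₃ -ᶻ y₃) +ᶻ (y₁ +ᶻ y₂ +ᶻ y₃) ≡ x₁ +ᶻ x₂ +ᶻ x₃
    cancel = solve-∀

  Raises₁ Raises₂ Raises₃ : TBasis n₁ n₂ n₃ → TBasis n₁ n₂ n₃ → Set
  Raises₁ (i₁ , i₂ , i₃) (j₁ , j₂ , j₃) = suc (toℕ i₁) ≡ toℕ j₁ × i₂ ≡ j₂ × i₃ ≡ j₃
  Raises₂ (i₁ , i₂ , i₃) (j₁ , j₂ , j₃) = i₁ ≡ j₁ × suc (toℕ i₂) ≡ toℕ j₂ × i₃ ≡ j₃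
  Raises₃ (i₁ , i₂ , i₃) (j₁ , j₂ , j₃) = i₁ ≡ j₁ × i₂ ≡ j₂ × suc (toℕ i₃) ≡ toℕ j₃

  tX-raises₁ : ∀ {I J} → Raises₁ I J → tX n₁ n₂ n₃ I J ≡ toℕ (proj₁ J)
  tX-raises₁ {i₁ , i₂ , i₃} {j₁ , _ , _} (step , refl , refl)
    rewrite vX-step step | δ-≢ (step⇒≢ step) | δ-refl i₂ | δ-refl i₃
    = m*1*1+0+0≡m (toℕ j₁)
    where m*1*1+0+0≡m : ∀ m → m * 1 * 1 + 0 + 0 ≡ m
          m*1*1+0+0≡m m = solve (m ∷ [])

  tX-raises₂ : ∀ {I J} → Raises₂ I J → tX n₁ n₂ n₃ I J ≡ toℕ (proj₁ (proj₂ J))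
  tX-raises₂ {i₁ , i₂ , i₃} {_ , j₂ , _} (refl , step , refl)
    rewrite vX-step step | δ-≢ (step⇒≢ step) | δ-refl i₁ | δ-refl i₃ | vX-refl i₁
    = 0*0*1+1*m*1+1*0*0≡m (toℕ j₂)
    where 0*0*1+1*m*1+1*0*0≡m : ∀ m → 0 * 0 * 1 + 1 * m * 1 + 1 * 0 * 0 ≡ m
          0*0*1+1*m*1+1*0*0≡m m = solve (m ∷ [])

  tX-raises₃ : ∀ {I J} → Raises₃ I J → tX n₁ n₂ n₃ I J ≡ toℕ (proj₂ (proj₂ J))
  tX-raises₃ {i₁ , i₂ , i₃} {_ , _ , j₃} (refl , refl , step)
    rewrite vX-step step | δ-≢ (step⇒≢ step) | δ-refl i₁ | δ-refl i₂ | vX-refl i₁ | vX-refl i₂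
    = 0*1*0+1*0*0+1*1*m≡m (toℕ j₃)
    where 0*1*0+1*0*0+1*1*m≡m : ∀ m → 0 * 1 * 0 + 1 * 0 * 0 + 1 * 1 * m ≡ m
          0*1*0+1*0*0+1*1*m≡m m = solve (m ∷ [])

  tX≢0⇒raises : ∀ {I J} → tX n₁ n₂ n₃ I J ≢ 0 → Raises₃ I J ⊎ Raises₂ I J ⊎ Raises₁ I J
  tX≢0⇒raises {i₁ , i₂ , i₃} {j₁ , j₂ , j₃} tX≢0
    with +≢0 (vX n₁ i₁ j₁ * δ i₂ j₂ * δ i₃ j₃ + δ i₁ j₁ * vX n₂ i₂ j₂ * δ i₃ j₃)
             (δ i₁ j₁ * δ i₂ j₂ * vX n₃ i₃ j₃) tX≢0
  ... | inj₂ t₃≢0 = let d₁ , d₂ , x₃ = *-*-≢0 _ _ _ t₃≢0 in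
    inj₁ (δ≢0⇒≡ d₁ , δ≢0⇒≡ d₂ , vX≢0⇒step x₃)
  ... | inj₁ t₁₂≢0 with +≢0 (vX n₁ i₁ j₁ * δ i₂ j₂ * δ i₃ j₃) (δ i₁ j₁ * vX n₂ i₂ j₂ * δ i₃ j₃) t₁₂≢0
  ...   | inj₂ t₂≢0 = let d₁ , x₂ , d₃ = *-*-≢0 _ _ _ t₂≢0 in
    inj₂ (inj₁ (δ≢0⇒≡ d₁ , vX≢0⇒step x₂ , δ≢0⇒≡ d₃))
  ...   | inj₁ t₁≢0 = let x₁ , d₂ , d₃ = *-*-≢0 _ _ _ t₁≢0 in
    inj₂ (inj₂ (vX≢0⇒step x₁ , δ≢0⇒≡ d₂ , δ≢0⇒≡ d₃))

  raises⇒tX≢0 : ∀ {I J} → Raises₃ I J ⊎ Raises₂ I J ⊎ Raises₁ I J → tX n₁ n₂ n₃ I J ≢ 0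
  raises⇒tX≢0 (inj₁ r@(_ , _ , step)) tX≡0 = ℕ.1+n≢0 (trans step (trans (sym (tX-raises₃ r)) tX≡0))
  raises⇒tX≢0 (inj₂ (inj₁ r@(_ , step , _))) tX≡0 = ℕ.1+n≢0 (trans step (trans (sym (tX-raises₂ r)) tX≡0))
  raises⇒tX≢0 (inj₂ (inj₂ r@(step , _ , _))) tX≡0 = ℕ.1+n≢0 (trans step (trans (sym (tX-raises₁ r)) tX≡0))

  tX≢0⇔raises : ∀ {I J} → (tX n₁ n₂ n₃ I J ≢ 0) ⇔ (Raises₃ I J ⊎ Raises₂ I J ⊎ Raises₁ I J)
  tX≢0⇔raises = mk⇔ tX≢0⇒raises raises⇒tX≢0

  raises₃-of : ∀ {I J} → suc (level I) ≡ level J → AtSame (position J) (position I) → Raises₃ I J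
  raises₃-of {i₁ , i₂ , i₃} {j₁ , j₂ , j₃} lev (q≡ , p≡)
    with refl ← toℕ-injective q≡ | refl ← toℕ-injective p≡ =
    refl , refl , ℕ.+-cancelˡ-≡ (toℕ i₁ + toℕ i₂) _ _ (trans (ℕ.+-suc _ _) lev)

  raises₂-of : ∀ {I J} → suc (level I) ≡ level J → OneLeft (position J) (position I) → Raises₂ I J
  raises₂-of {i₁ , i₂ , i₃} {j₁ , j₂ , j₃} lev (step , p≡) with refl ← toℕ-injective p≡ =
    refl , step , toℕ-injective (ℕ.+-cancelˡ-≡ (suc (toℕ i₁ + toℕ i₂)) _ _ (begin
      suc (toℕ i₁ + toℕ i₂ + toℕ i₃) ≡⟨ lev ⟩
      toℕ i₁ + toℕ j₂ + toℕ j₃       ≡⟨ cong (λ k → toℕ i₁ + k + toℕ j₃) step ⟨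
      toℕ i₁ + suc (toℕ i₂) + toℕ j₃ ≡⟨ cong (_+ toℕ j₃) (ℕ.+-suc (toℕ i₁) (toℕ i₂)) ⟩
      suc (toℕ i₁ + toℕ i₂ + toℕ j₃) ∎))

  raises₁-of : ∀ {I J} → suc (level I) ≡ level J → OneBelow (position J) (position I) → Raises₁ I J
  raises₁-of {i₁ , i₂ , i₃} {j₁ , j₂ , j₃} lev (q≡ , step) with refl ← toℕ-injective q≡ =
    step , refl , toℕ-injective (ℕ.+-cancelˡ-≡ (suc (toℕ i₁ + toℕ i₂)) _ _
      (trans lev (cong (λ k → k + toℕ i₂ + toℕ j₃) (sym step))))

  raises⇔adjCoords : ∀ {I J} → suc (level I) ≡ level J →
    (Raises₃ I J ⊎ Raises₂ I J ⊎ Raises₁ I J) ⇔ AdjCoords (position J) (position I)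
  raises⇔adjCoords {i₁ , i₂ , i₃} {j₁ , j₂ , j₃} lev = mk⇔ to from
    where
    to : Raises₃ _ _ ⊎ Raises₂ _ _ ⊎ Raises₁ _ _ →
         AdjCoords (position (j₁ , j₂ , j₃)) (position (i₁ , i₂ , i₃))
    to (inj₁ (refl , refl , _))        = inj₁ (refl , refl)
    to (inj₂ (inj₁ (refl , step , _))) = inj₂ (inj₁ (step , refl))
    to (inj₂ (inj₂ (step , refl , _))) = inj₂ (inj₂ (refl , step))
    from : AdjCoords (position (j₁ , j₂ , j₃)) (position (i₁ , i₂ , i₃)) →
           Raises₃ _ _ ⊎ Raises₂ _ _ ⊎ Raises₁ _ _
    from (inj₁ same)         = inj₁ (raises₃-of lev same)
    from (inj₂ (inj₁ left))  = inj₂ (inj₁ (raises₂-of lev left))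
    from (inj₂ (inj₂ below)) = inj₂ (inj₂ (raises₁-of lev below))

subst-⇔ : {X : Set} (P : X → Set) {x y : X} → x ≡ y → P x ⇔ P y
subst-⇔ P eq = mk⇔ (subst P eq) (subst P (sym eq))

i+k-k≡i : ∀ i k → i +ᶻ k -ᶻ k ≡ i
i+k-k≡i = solve-∀

i-k+k≡i : ∀ i k → i -ᶻ k +ᶻ k ≡ i
i-k+k≡i = solve-∀

+ᶻ-cancelʳ-≤ : ∀ k {i j} → i +ᶻ k ≤ᶻ j +ᶻ k → i ≤ᶻ j
+ᶻ-cancelʳ-≤ k {i} {j} le = subst₂ _≤ᶻ_ (i+k-k≡i i k) (i+k-k≡i j k) (ℤ.+-monoˡ-≤ (- k) le)

m-k≤n⇔m≤n+k : ∀ m k n → (+ m -ᶻ + k ≤ᶻ + n) ⇔ (m ≤ n + k)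
m-k≤n⇔m≤n+k m k n = mk⇔
  (λ le → ℤ.drop‿+≤+ (subst (_≤ᶻ + (n + k)) (i-k+k≡i (+ m) (+ k)) (ℤ.+-monoˡ-≤ (+ k) le)))
  (λ le → +ᶻ-cancelʳ-≤ (+ k) (subst (_≤ᶻ + (n + k)) (sym (i-k+k≡i (+ m) (+ k))) (+≤+ le)))

n≤m-k⇔n+k≤m : ∀ n m k → (+ n ≤ᶻ + m -ᶻ + k) ⇔ (n + k ≤ m)
n≤m-k⇔n+k≤m n m k = mk⇔
  (λ le → ℤ.drop‿+≤+ (subst (+ (n + k) ≤ᶻ_) (i-k+k≡i (+ m) (+ k)) (ℤ.+-monoˡ-≤ (+ k) le)))
  (λ le → +ᶻ-cancelʳ-≤ (+ k) (subst (+ (n + k) ≤ᶻ_) (sym (i-k+k≡i (+ m) (+ k))) (+≤+ le)))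

-k≤m-k : ∀ m k → - (+ k) ≤ᶻ + m -ᶻ + k
-k≤m-k m k = +ᶻ-cancelʳ-≤ (+ k) (subst₂ _≤ᶻ_ (sym (-k+k≡0 (+ k))) (sym (i-k+k≡i (+ m) (+ k))) (+≤+ ℕ.z≤n))
  where
  -k+k≡0 : ∀ k → - k +ᶻ k ≡ + 0
  -k+k≡0 = solve-∀

+∣i+k∣≡i+k : ∀ {i} k → - k ≤ᶻ i → + ∣ i +ᶻ k ∣ ≡ i +ᶻ k
+∣i+k∣≡i+k {i} k le = ℤ.0≤i⇒+∣i∣≡i (subst (_≤ᶻ i +ᶻ k) (-k+k≡0 k) (ℤ.+-monoˡ-≤ k le))
  where
  -k+k≡0 : ∀ k → - k +ᶻ k ≡ + 0
  -k+k≡0 = solve-∀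

≡⇔+≡ : ∀ {n m j i} → + n ≡ j → + m ≡ i → (n ≡ m) ⇔ (j ≡ i)
≡⇔+≡ refl refl = mk⇔ (cong (+_)) ℤ.+-injective

suc≡⇔+≡-1 : ∀ {n m j i} → + n ≡ j → + m ≡ i → (suc n ≡ m) ⇔ (j ≡ i -ᶻ + 1)
suc≡⇔+≡-1 {n} {m} refl refl = mk⇔
  (λ eq → trans (sym (1+i-1≡i (+ n))) (cong (λ k → + k -ᶻ + 1) eq))
  (λ eq → ℤ.+-injective (trans (cong (+ 1 +ᶻ_) eq) (1+[i-1]≡i (+ m))))
  where
  1+i-1≡i : ∀ i → + 1 +ᶻ i -ᶻ + 1 ≡ i
  1+i-1≡i = solve-∀
  1+[i-1]≡i : ∀ i → + 1 +ᶻ (i -ᶻ + 1) ≡ i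
  1+[i-1]≡i = solve-∀

-ᶻ-cancel⇔ : ∀ k {i j} → (i ≡ j) ⇔ (i -ᶻ k ≡ j -ᶻ k)
-ᶻ-cancel⇔ k = mk⇔ (cong (_-ᶻ k)) (+ᶻ-cancelʳ-≡ (- k) _ _)

≡⇔-ᶻ≡ : ∀ k {n m j i} → + n -ᶻ k ≡ j → + m -ᶻ k ≡ i → (n ≡ m) ⇔ (j ≡ i)
≡⇔-ᶻ≡ k refl refl = ⇔-trans (≡⇔+≡ refl refl) (-ᶻ-cancel⇔ k)

suc≡⇔-ᶻ≡-1 : ∀ k {n m j i} → + n -ᶻ k ≡ j → + m -ᶻ k ≡ i → (suc n ≡ m) ⇔ (j ≡ i -ᶻ + 1)
suc≡⇔-ᶻ≡-1 k {n} {m} refl refl =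
  ⇔-trans (suc≡⇔+≡-1 refl refl) (⇔-trans (-ᶻ-cancel⇔ k) (subst-⇔ (+ n -ᶻ k ≡_) (swap (+ m) k)))
  where
  swap : ∀ i k → i -ᶻ + 1 -ᶻ k ≡ i -ᶻ k -ᶻ + 1
  swap = solve-∀

+≡+⇒≤⇔≥ : ∀ {x y u v} → x + y ≡ u + v → (x ≤ u ⇔ v ≤ y)
+≡+⇒≤⇔≥ {x} {y} {u} {v} eq = mk⇔
  (λ x≤u → ℕ.+-cancelˡ-≤ u v y (ℕ.≤-trans (ℕ.≤-reflexive (sym eq)) (ℕ.+-monoˡ-≤ y x≤u)))
  (λ v≤y → ℕ.+-cancelʳ-≤ y x u (ℕ.≤-trans (ℕ.≤-reflexive eq) (ℕ.+-monoʳ-≤ u v≤y)))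

module Hexagon (A B C : ℕ) where

  a b c N : ℕ
  a = suc A
  b = suc B
  c = suc C
  N = a + b + c

  open Rep a b c
  open Hex a b c

  weight⇔level : ∀ s v → (tWeight n₁ n₂ n₃ v ≡ + (2 * s) -ᶻ + 1) ⇔ (suc s + level v ≡ N)
  weight⇔level s v = mk⇔
    (λ eq → ℕ.*-cancelˡ-≡ _ _ 2 (ℤ.+-injective
      (trans (sym (shifted-target s)) (trans (cong (_+ᶻ K) (sym eq)) shifted-weight))))
    (λ eq → +ᶻ-cancelʳ-≡ K _ _
      (trans shifted-weight (trans (cong (λ n → + (2 * n)) (sym eq)) (sym (shifted-target s)))))
    where
    L = level v
    K = + (2 * L) +ᶻ + 3
    dims+3 : n₁ + n₂ + n₃ + 3 ≡ 2 * N
    dims+3 = dims A B C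
      where
      dims : ∀ A B C → B + suc C + (A + suc C) + (A + suc B) + 3 ≡ 2 * (suc A + suc B + suc C)
      dims A B C = solve (A ∷ B ∷ C ∷ [])
    shifted-weight : tWeight n₁ n₂ n₃ v +ᶻ K ≡ + (2 * N)
    shifted-weight = begin
      tWeight n₁ n₂ n₃ v +ᶻ (+ (2 * L) +ᶻ + 3) ≡⟨ ℤ.+-assoc (tWeight n₁ n₂ n₃ v) _ _ ⟨
      tWeight n₁ n₂ n₃ v +ᶻ + (2 * L) +ᶻ + 3   ≡⟨ cong (_+ᶻ + 3) (tWeight+2level v) ⟩
      + (n₁ + n₂ + n₃ + 3)                     ≡⟨ cong (+_) dims+3 ⟩
      + (2 * N)                                ∎
    shifted-target : ∀ s → + (2 * s) -ᶻ + 1 +ᶻ K ≡ + (2 * (suc s + L))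
    shifted-target s = trans (ring (+ (2 * s)) (+ (2 * L))) (cong (+_) (2*-distrib s L))
      where
      ring : ∀ i j → i -ᶻ + 1 +ᶻ (j +ᶻ + 3) ≡ i +ᶻ j +ᶻ + 2
      ring = solve-∀
      2*-distrib : ∀ s l → 2 * s + 2 * l + 2 ≡ 2 * (suc s + l)
      2*-distrib s l = solve (s ∷ l ∷ [])

  -- InTriangle s (q , p): the triangle U(q - c , p) (s = 0), resp. D(q - c , p) (s = 1), lies in H(a,b,c).
  InTriangle : ℕ → ℕ × ℕ → Set
  InTriangle s (q , p) = p < b + c × q < a + c × c ≤ s + (p + q) × suc s + (p + q) ≤ N

  Coords : ℕ → Set
  Coords s = Σ (ℕ × ℕ) (InTriangle s)

  InTriangle-irrelevant : ∀ s t → Irrelevant (InTriangle s t)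
  InTriangle-irrelevant s t =
    ×-irrelevant ℕ.≤-irrelevant (×-irrelevant ℕ.≤-irrelevant (×-irrelevant ℕ.≤-irrelevant ℕ.≤-irrelevant))

  eig↔coords : ∀ s → EigBasis (+ (2 * s) -ᶻ + 1) ↔ Coords s
  eig↔coords s =
    Σ-↔-proj₁ (λ _ → Decidable⇒UIP.≡-irrelevant ℤ._≟_) (InTriangle-irrelevant s) to from to∘from from∘to
    where
    shuffle : ∀ m r → suc r + (s + m) ≡ suc s + m + r
    shuffle m r = solve (s ∷ m ∷ r ∷ [])

    budget : ∀ {m r} → suc s + m + r ≡ N → (suc r ≤ a + b ⇔ c ≤ s + m)
    budget {m} {r} full = +≡+⇒≤⇔≥ (trans (shuffle m r) full)

    full-level : (e : EigBasis (+ (2 * s) -ᶻ + 1)) → let (j₁ , j₂ , j₃) = proj₁ e in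
                 suc s + (toℕ j₁ + toℕ j₂) + toℕ j₃ ≡ N
    full-level (v , w) = trans (ℕ.+-assoc (suc s) _ _) (Equivalence.to (weight⇔level s v) w)

    to : EigBasis (+ (2 * s) -ᶻ + 1) → Coords s
    to e@((j₁ , j₂ , j₃) , _) = (toℕ j₂ , toℕ j₁) ,
      toℕ<n j₁ , toℕ<n j₂ , Equivalence.to (budget (full-level e)) (toℕ<n j₃) ,
      ℕ.≤-trans (ℕ.m≤m+n _ (toℕ j₃)) (ℕ.≤-reflexive (full-level e))

    from : Coords s → EigBasis (+ (2 * s) -ᶻ + 1)
    from ((q , p) , p< , q< , c≤ , ≤N) = v , Equivalence.from (weight⇔level s v) level≡
      where
      r = N ∸ (suc s + (p + q))
      full : suc s + (p + q) + r ≡ N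
      full = ℕ.m+[n∸m]≡n ≤N
      r< : r < a + b
      r< = Equivalence.from (budget full) c≤
      v : Basis
      v = fromℕ< p< , fromℕ< q< , fromℕ< r<
      level≡ : suc s + (toℕ (fromℕ< p<) + toℕ (fromℕ< q<) + toℕ (fromℕ< r<)) ≡ N
      level≡ = begin
        suc s + (toℕ (fromℕ< p<) + toℕ (fromℕ< q<) + toℕ (fromℕ< r<))
          ≡⟨ cong (λ l → suc s + l) (cong₂ _+_ (cong₂ _+_ (toℕ-fromℕ< p<) (toℕ-fromℕ< q<)) (toℕ-fromℕ< r<)) ⟩
        suc s + (p + q + r) ≡⟨ ℕ.+-assoc (suc s) (p + q) r ⟨
        suc s + (p + q) + r ≡⟨ full ⟩
        N ∎

    to∘from : ∀ t → proj₁ (to (from t)) ≡ proj₁ t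
    to∘from ((q , p) , p< , q< , _) = cong₂ _,_ (toℕ-fromℕ< q<) (toℕ-fromℕ< p<)

    from∘to : ∀ e → proj₁ (from (to e)) ≡ proj₁ e
    from∘to e@((j₁ , j₂ , j₃) , _) =
      cong₂ _,_ (fromℕ<-toℕ j₁ _) (cong₂ _,_ (fromℕ<-toℕ j₂ _) (toℕ-injective (trans (toℕ-fromℕ< _) r≡j₃)))
      where
      r≡j₃ : N ∸ (suc s + (toℕ j₁ + toℕ j₂)) ≡ toℕ j₃
      r≡j₃ = trans (cong (_∸ (suc s + (toℕ j₁ + toℕ j₂))) (sym (full-level e)))
                   (ℕ.m+n∸m≡n (suc s + (toℕ j₁ + toℕ j₂)) (toℕ j₃))

  -- InHexCoords q p: the lattice point (q - c , p) lies in H(a,b,c).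
  InHexCoords : ℕ → ℕ → Set
  InHexCoords q p = p ≤ b + c × q ≤ a + c × c ≤ p + q × p + q ≤ N

  InHex⇔ : ∀ q p → InHex (+ q -ᶻ + c) (+ p) ⇔ InHexCoords q p
  InHex⇔ q p = mk⇔
    (λ { ((_ , p≤) , (_ , x≤) , (0≤x+y , x+y≤)) →
         ℤ.drop‿+≤+ p≤ , Equivalence.to (m-k≤n⇔m≤n+k q c a) x≤ ,
         Equivalence.to (n≤m-k⇔n+k≤m 0 (p + q) c) (subst (+ 0 ≤ᶻ_) x+y≡ 0≤x+y) ,
         Equivalence.to (m-k≤n⇔m≤n+k (p + q) c (a + b)) (subst (_≤ᶻ + (a + b)) x+y≡ x+y≤) })
    (λ { (p≤ , q≤ , c≤ , ≤N) →
         (+≤+ ℕ.z≤n , +≤+ p≤) , (-k≤m-k q c , Equivalence.from (m-k≤n⇔m≤n+k q c a) q≤) ,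
         (subst (+ 0 ≤ᶻ_) (sym x+y≡) (Equivalence.from (n≤m-k⇔n+k≤m 0 (p + q) c) c≤) ,
          subst (_≤ᶻ + (a + b)) (sym x+y≡) (Equivalence.from (m-k≤n⇔m≤n+k (p + q) c (a + b)) ≤N)) })
    where
    x+y≡ : + q -ᶻ + c +ᶻ + p ≡ + (p + q) -ᶻ + c
    x+y≡ = ring (+ q) (+ c) (+ p)
      where
      ring : ∀ i k j → i -ᶻ k +ᶻ j ≡ j +ᶻ i -ᶻ k
      ring = solve-∀

  up-vertices⇔ : ∀ q p → (InHexCoords q p × InHexCoords (suc q) p × InHexCoords q (suc p)) ⇔ InTriangle 0 (q , p)
  up-vertices⇔ q p = mk⇔
    (λ { ((_ , _ , c≤ , _) , (_ , q< , _ , _) , (p< , _ , _ , ≤N)) → p< , q< , c≤ , ≤N })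
    (λ { (p< , q< , c≤ , ≤N) →
         (ℕ.<⇒≤ p< , ℕ.<⇒≤ q< , c≤ , ℕ.<⇒≤ ≤N) ,
         (ℕ.<⇒≤ p< , q< , ℕ.≤-trans c≤ (ℕ.+-monoʳ-≤ p (ℕ.n≤1+n q)) , subst (_≤ N) (sym (ℕ.+-suc p q)) ≤N) ,
         (p< , ℕ.<⇒≤ q< , ℕ.m≤n⇒m≤1+n c≤ , ≤N) })

  down-vertices⇔ : ∀ q p →
    (InHexCoords (suc q) p × InHexCoords q (suc p) × InHexCoords (suc q) (suc p)) ⇔ InTriangle 1 (q , p)
  down-vertices⇔ q p = mk⇔
    (λ { ((_ , q< , _ , _) , (p< , _ , c≤ , _) , (_ , _ , _ , ≤N)) →
         p< , q< , c≤ , subst (_≤ N) (cong suc (ℕ.+-suc p q)) ≤N })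
    (λ { (p< , q< , c≤ , ≤N) →
         (ℕ.<⇒≤ p< , q< , subst (c ≤_) (sym (ℕ.+-suc p q)) c≤ , subst (_≤ N) (sym (ℕ.+-suc p q)) (ℕ.<⇒≤ ≤N)) ,
         (p< , ℕ.<⇒≤ q< , c≤ , ℕ.<⇒≤ ≤N) ,
         (p< , q< , ℕ.≤-trans c≤ (ℕ.s≤s (ℕ.+-monoʳ-≤ p (ℕ.n≤1+n q))) ,
          subst (_≤ N) (sym (cong suc (ℕ.+-suc p q))) ≤N) })

  InHex+1⇔ : ∀ q p → InHex (+ q -ᶻ + c +ᶻ + 1) (+ p) ⇔ InHexCoords (suc q) p
  InHex+1⇔ q p = ⇔-trans (subst-⇔ (λ x → InHex x (+ p)) (ring (+ q) (+ c))) (InHex⇔ (suc q) p)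
    where
    ring : ∀ i k → i -ᶻ k +ᶻ + 1 ≡ + 1 +ᶻ i -ᶻ k
    ring = solve-∀

  +p+1≡+[1+p] : ∀ p → + p +ᶻ + 1 ≡ + suc p
  +p+1≡+[1+p] p = cong (+_) (ℕ.+-comm p 1)

  UpIn⇔ : ∀ q p → UpIn (+ q -ᶻ + c) (+ p) ⇔ InTriangle 0 (q , p)
  UpIn⇔ q p = ⇔-trans
    (InHex⇔ q p ×-⇔ InHex+1⇔ q p ×-⇔ ⇔-trans (subst-⇔ (InHex (+ q -ᶻ + c)) (+p+1≡+[1+p] p)) (InHex⇔ q (suc p)))
    (up-vertices⇔ q p)

  DownIn⇔ : ∀ q p → DownIn (+ q -ᶻ + c) (+ p) ⇔ InTriangle 1 (q , p)
  DownIn⇔ q p = ⇔-trans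
    (InHex+1⇔ q p ×-⇔ ⇔-trans (subst-⇔ (InHex (+ q -ᶻ + c)) (+p+1≡+[1+p] p)) (InHex⇔ q (suc p))
                      ×-⇔ ⇔-trans (subst-⇔ (InHex (+ q -ᶻ + c +ᶻ + 1)) (+p+1≡+[1+p] p)) (InHex+1⇔ q (suc p)))
    (down-vertices⇔ q p)

  InHex-irrelevant : ∀ x y → Irrelevant (InHex x y)
  InHex-irrelevant x y = ×-irrelevant ≤²-irrelevant (×-irrelevant ≤²-irrelevant ≤²-irrelevant)
    where
    ≤²-irrelevant : ∀ {i j k l} → Irrelevant (i ≤ᶻ j × k ≤ᶻ l)
    ≤²-irrelevant = ×-irrelevant ℤ.≤-irrelevant ℤ.≤-irrelevant

  lattice↔coords : ∀ s (T : ℤ → ℤ → Set) → (∀ x y → Irrelevant (T x y)) →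
    (∀ {x y} → T x y → - (+ c) ≤ᶻ x × + 0 ≤ᶻ y) →
    (∀ q p → T (+ q -ᶻ + c) (+ p) ⇔ InTriangle s (q , p)) →
    Σ (ℤ × ℤ) (λ z → T (proj₁ z) (proj₂ z)) ↔ Coords s
  lattice↔coords s T T-irr bounds T⇔ =
    Σ-↔-proj₁ (λ z → T-irr (proj₁ z) (proj₂ z)) (InTriangle-irrelevant s) to from to∘from from∘to
    where
    x≡ : ∀ {x y} → T x y → + ∣ x +ᶻ + c ∣ -ᶻ + c ≡ x
    x≡ {x} t = trans (cong (_-ᶻ + c) (+∣i+k∣≡i+k (+ c) (proj₁ (bounds t)))) (i+k-k≡i x (+ c))
    y≡ : ∀ {x y} → T x y → + ∣ y ∣ ≡ y
    y≡ t = ℤ.0≤i⇒+∣i∣≡i (proj₂ (bounds t))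
    to : Σ (ℤ × ℤ) (λ z → T (proj₁ z) (proj₂ z)) → Coords s
    to ((x , y) , t) = (∣ x +ᶻ + c ∣ , ∣ y ∣) , Equivalence.to (T⇔ _ _) (subst₂ T (sym (x≡ t)) (sym (y≡ t)) t)
    from : Coords s → Σ (ℤ × ℤ) (λ z → T (proj₁ z) (proj₂ z))
    from ((q , p) , h) = (+ q -ᶻ + c , + p) , Equivalence.from (T⇔ q p) h
    to∘from : ∀ t → proj₁ (to (from t)) ≡ proj₁ t
    to∘from ((q , p) , _) = cong (λ i → ∣ i ∣ , p) (i-k+k≡i (+ q) (+ c))
    from∘to : ∀ u → proj₁ (from (to u)) ≡ proj₁ u
    from∘to (_ , t) = cong₂ _,_ (x≡ t) (y≡ t)

  up↔coords : Up ↔ Coords 0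
  up↔coords = lattice↔coords 0 UpIn
    (λ x y → ×-irrelevant (InHex-irrelevant _ _) (×-irrelevant (InHex-irrelevant _ _) (InHex-irrelevant _ _)))
    (λ { (((0≤y , _) , (-c≤x , _) , _) , _) → -c≤x , 0≤y })
    UpIn⇔

  down↔coords : Down ↔ Coords 1
  down↔coords = lattice↔coords 1 DownIn
    (λ x y → ×-irrelevant (InHex-irrelevant _ _) (×-irrelevant (InHex-irrelevant _ _) (InHex-irrelevant _ _)))
    (λ { (((0≤y , _) , _) , (_ , (-c≤x , _) , _) , _) → -c≤x , 0≤y })
    DownIn⇔

  τ : EigBasis (- (+ 1)) ↔ Up
  τ = ↔-trans (eig↔coords 0) (↔-sym up↔coords)

  σ : EigBasis (+ 1) ↔ Down
  σ = ↔-trans (eig↔coords 1) (↔-sym down↔coords)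

  basisAt : ∀ s → Coords s → Basis
  basisAt s t = proj₁ (Inverse.from (eig↔coords s) t)

  position-basisAt : ∀ s t → position (basisAt s t) ≡ proj₁ t
  position-basisAt s ((q , p) , p< , q< , _) = cong₂ _,_ (toℕ-fromℕ< q<) (toℕ-fromℕ< p<)

  level-basisAt : ∀ s t → suc s + level (basisAt s t) ≡ N
  level-basisAt s t = Equivalence.to (weight⇔level s (basisAt s t)) (proj₂ (Inverse.from (eig↔coords s) t))

  module TriangleBasis (s : ℕ) {P : ℤ × ℤ → Set} (ℓ : Σ (ℤ × ℤ) P ↔ Coords s)
    (position-from : ∀ t → proj₁ (Inverse.from ℓ t) ≡ (+ proj₁ (proj₁ t) -ᶻ + c , + proj₂ (proj₁ t))) where

    basis : Σ (ℤ × ℤ) P → Basis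
    basis u = basisAt s (Inverse.to ℓ u)

    coordinates : ∀ u → (+ toℕ (proj₁ (proj₂ (basis u))) -ᶻ + c , + toℕ (proj₁ (basis u))) ≡ proj₁ u
    coordinates u = begin
      (+ toℕ (proj₁ (proj₂ (basis u))) -ᶻ + c , + toℕ (proj₁ (basis u)))
        ≡⟨ cong (λ t → + proj₁ t -ᶻ + c , + proj₂ t) (position-basisAt s (Inverse.to ℓ u)) ⟩
      (+ proj₁ (proj₁ (Inverse.to ℓ u)) -ᶻ + c , + proj₂ (proj₁ (Inverse.to ℓ u)))
        ≡⟨ position-from (Inverse.to ℓ u) ⟨
      proj₁ (Inverse.from ℓ (Inverse.to ℓ u))
        ≡⟨ cong proj₁ (Inverse.strictlyInverseʳ ℓ u) ⟩
      proj₁ u ∎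

    x-coordinate : ∀ u → + toℕ (proj₁ (proj₂ (basis u))) -ᶻ + c ≡ proj₁ (proj₁ u)
    x-coordinate u = ,-injectiveˡ (coordinates u)

    y-coordinate : ∀ u → + toℕ (proj₁ (basis u)) ≡ proj₂ (proj₁ u)
    y-coordinate u = ,-injectiveʳ (coordinates u)

    level-basis : ∀ u → suc s + level (basis u) ≡ N
    level-basis u = level-basisAt s (Inverse.to ℓ u)

  module UpBasis = TriangleBasis 0 up↔coords (λ _ → refl)
  module DownBasis = TriangleBasis 1 down↔coords (λ _ → refl)

  p̂ q̂ r̂ : Up → ℕ
  p̂ U = toℕ (proj₁ (UpBasis.basis U))
  q̂ U = toℕ (proj₁ (proj₂ (UpBasis.basis U)))
  r̂ U = toℕ (proj₂ (proj₂ (UpBasis.basis U)))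

  p̌ q̌ : Down → ℕ
  p̌ D = toℕ (proj₁ (DownBasis.basis D))
  q̌ D = toℕ (proj₁ (proj₂ (DownBasis.basis D)))

  x-same⇔ : ∀ U D → (q̌ D ≡ q̂ U) ⇔ (proj₁ (proj₁ D) ≡ proj₁ (proj₁ U))
  x-same⇔ U D = ≡⇔-ᶻ≡ (+ c) (DownBasis.x-coordinate D) (UpBasis.x-coordinate U)

  x-left⇔ : ∀ U D → (suc (q̌ D) ≡ q̂ U) ⇔ (proj₁ (proj₁ D) ≡ proj₁ (proj₁ U) -ᶻ + 1)
  x-left⇔ U D = suc≡⇔-ᶻ≡-1 (+ c) (DownBasis.x-coordinate D) (UpBasis.x-coordinate U)

  y-same⇔ : ∀ U D → (p̌ D ≡ p̂ U) ⇔ (proj₂ (proj₁ D) ≡ proj₂ (proj₁ U))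
  y-same⇔ U D = ≡⇔+≡ (DownBasis.y-coordinate D) (UpBasis.y-coordinate U)

  y-below⇔ : ∀ U D → (suc (p̌ D) ≡ p̂ U) ⇔ (proj₂ (proj₁ D) ≡ proj₂ (proj₁ U) -ᶻ + 1)
  y-below⇔ U D = suc≡⇔+≡-1 (DownBasis.y-coordinate D) (UpBasis.y-coordinate U)

  levels : ∀ U D → suc (level (DownBasis.basis D)) ≡ level (UpBasis.basis U)
  levels U D = ℕ.suc-injective (trans (DownBasis.level-basis D) (sym (UpBasis.level-basis U)))

  w : Up → Down → ℕ
  w U D = Xm1 (Inverse.from σ D) (Inverse.from τ U)

  adjacency : ∀ U D → (w U D ≢ 0) ⇔ Adj U D
  adjacency U@((_ , _) , _) D@((_ , _) , _) =
    ⇔-trans tX≢0⇔raises (⇔-trans (raises⇔adjCoords (levels U D))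
      (   (x-same⇔ U D ×-⇔ y-same⇔ U D)
       ⊎-⇔ (x-left⇔ U D ×-⇔ y-same⇔ U D)
       ⊎-⇔ (x-same⇔ U D ×-⇔ y-below⇔ U D)))

  w-same : ∀ U D → proj₁ D ≡ proj₁ U → w U D ≡ r̂ U
  w-same U D refl = tX-raises₃ (raises₃-of (levels U D)
    (Equivalence.from (x-same⇔ U D) refl , Equivalence.from (y-same⇔ U D) refl))

  w-left : ∀ U D → proj₁ D ≡ (proj₁ (proj₁ U) -ᶻ + 1 , proj₂ (proj₁ U)) → w U D ≡ q̂ U
  w-left U D refl = tX-raises₂ (raises₂-of (levels U D)
    (Equivalence.from (x-left⇔ U D) refl , Equivalence.from (y-same⇔ U D) refl))

  w-below : ∀ U D → proj₁ D ≡ (proj₁ (proj₁ U) , proj₂ (proj₁ U) -ᶻ + 1) → w U D ≡ p̂ U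
  w-below U D refl = tX-raises₁ (raises₁-of (levels U D)
    (Equivalence.from (x-same⇔ U D) refl , Equivalence.from (y-below⇔ U D) refl))

  r̂-determined : ∀ U U′ → p̂ U + q̂ U ≡ p̂ U′ + q̂ U′ → r̂ U ≡ r̂ U′
  r̂-determined U U′ eq = ℕ.+-cancelˡ-≡ (p̂ U′ + q̂ U′) _ _
    (trans (cong (_+ r̂ U) (sym eq)) (ℕ.suc-injective (trans (UpBasis.level-basis U) (sym (UpBasis.level-basis U′)))))

  face-flat : ∀ {x y} U₁ U₃ U₅ D₂ D₄ D₆ →
    proj₁ U₁ ≡ (x , y) → proj₁ U₃ ≡ (x -ᶻ + 1 , y) → proj₁ U₅ ≡ (x , y -ᶻ + 1) →
    proj₁ D₂ ≡ (x -ᶻ + 1 , y) → proj₁ D₄ ≡ (x -ᶻ + 1 , y -ᶻ + 1) → proj₁ D₆ ≡ (x , y -ᶻ + 1) →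
    w U₁ D₂ * w U₃ D₄ * w U₅ D₆ ≡ w U₃ D₂ * w U₅ D₄ * w U₁ D₆
  face-flat U₁ U₃ U₅ D₂ D₄ D₆ refl refl refl refl refl refl = begin
    w U₁ D₂ * w U₃ D₄ * w U₅ D₆
      ≡⟨ cong₂ _*_ (cong₂ _*_ (w-left U₁ D₂ refl) (w-below U₃ D₄ refl)) (w-same U₅ D₆ refl) ⟩
    q̂ U₁ * p̂ U₃ * r̂ U₅
      ≡⟨ cong₂ _*_ (cong₂ _*_ q̂₁≡q̂₅ p̂₃≡p̂₁) r̂₅≡r̂₃ ⟩
    q̂ U₅ * p̂ U₁ * r̂ U₃
      ≡⟨ rotate (q̂ U₅) (p̂ U₁) (r̂ U₃) ⟩
    r̂ U₃ * q̂ U₅ * p̂ U₁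
      ≡⟨ cong₂ _*_ (cong₂ _*_ (w-same U₃ D₂ refl) (w-left U₅ D₄ refl)) (w-below U₁ D₆ refl) ⟨
    w U₃ D₂ * w U₅ D₄ * w U₁ D₆ ∎
    where
    q̂₁≡q̂₅ : q̂ U₁ ≡ q̂ U₅
    q̂₁≡q̂₅ = Equivalence.from (≡⇔-ᶻ≡ (+ c) (UpBasis.x-coordinate U₁) (UpBasis.x-coordinate U₅)) refl
    p̂₃≡p̂₁ : p̂ U₃ ≡ p̂ U₁
    p̂₃≡p̂₁ = Equivalence.from (≡⇔+≡ (UpBasis.y-coordinate U₃) (UpBasis.y-coordinate U₁)) refl
    1+p̂₅≡p̂₃ : suc (p̂ U₅) ≡ p̂ U₃
    1+p̂₅≡p̂₃ = Equivalence.from (suc≡⇔+≡-1 (UpBasis.y-coordinate U₅) (UpBasis.y-coordinate U₃)) refl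
    1+q̂₃≡q̂₅ : suc (q̂ U₃) ≡ q̂ U₅
    1+q̂₃≡q̂₅ = Equivalence.from (suc≡⇔-ᶻ≡-1 (+ c) (UpBasis.x-coordinate U₃) (UpBasis.x-coordinate U₅)) refl
    r̂₅≡r̂₃ : r̂ U₅ ≡ r̂ U₃
    r̂₅≡r̂₃ = r̂-determined U₅ U₃ (begin
      p̂ U₅ + q̂ U₅       ≡⟨ cong (λ k → p̂ U₅ + k) 1+q̂₃≡q̂₅ ⟨
      p̂ U₅ + suc (q̂ U₃) ≡⟨ ℕ.+-suc (p̂ U₅) (q̂ U₃) ⟩
      suc (p̂ U₅) + q̂ U₃ ≡⟨ cong (_+ q̂ U₃) 1+p̂₅≡p̂₃ ⟩
      p̂ U₃ + q̂ U₃       ∎)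
    rotate : ∀ k l m → k * l * m ≡ m * k * l
    rotate k l m = solve (k ∷ l ∷ m ∷ [])

  kasteleyn-flat : IsKFlatAdjacency w
  kasteleyn-flat = adjacency , λ x y p₁ p₂ p₃ p₄ p₅ p₆ → face-flat
    ((x , y) , p₁) ((x -ᶻ + 1 , y) , p₃) ((x , y -ᶻ + 1) , p₅)
    ((x -ᶻ + 1 , y) , p₂) ((x -ᶻ + 1 , y -ᶻ + 1) , p₄) ((x , y -ᶻ + 1) , p₆)
    refl refl refl refl refl refl

proposition1 : (a b c : ℕ) → 0 < a → 0 < b → 0 < c →
    -- identification: eigenvalue-(-1) basis ↔ Up, eigenvalue-1 basis ↔ Down
    (Σ (Rep.EigBasis a b c (- (+ 1)) ↔ Hex.Up a b c) λ τ →
     Σ (Rep.EigBasis a b c (+ 1) ↔ Hex.Down a b c) λ σ →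
       Hex.IsKFlatAdjacency a b c
         (λ U D → Rep.Xm1 a b c (Inverse.from σ D) (Inverse.from τ U)))
    ⊎
    -- or the other way round: eigenvalue-(-1) basis ↔ Down, eigenvalue-1 basis ↔ Up
    (Σ (Rep.EigBasis a b c (- (+ 1)) ↔ Hex.Down a b c) λ τ →
     Σ (Rep.EigBasis a b c (+ 1) ↔ Hex.Up a b c) λ σ →
       Hex.IsKFlatAdjacency a b c
         (λ U D → Rep.Xm1 a b c (Inverse.from σ U) (Inverse.from τ D)))
proposition1 (suc A) (suc B) (suc C) _ _ _ = inj₁ (τ , σ , kasteleyn-flat)
  where open Hexagon A B C
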